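{- Let $\mathbf{p}(x)=x^3+a_2x^2+a_1x+a_0\in\mathbb{Z}[x]$ be irreducible and let $\theta$ be a root of $\mathbf{p}$. Then $\mathbf{S}\subset\mathcal{R}_{\theta,1}(\infty,\infty)$.
   Context: $\mathcal{R}_{\theta,1}(\infty,\infty)$ is the set of pairs $(\omega_1,\omega_2)\in\mathbb{Z}[\theta]\times\mathbb{Z}[\theta]$ such that $\omega_1^2+\omega_2^2=n-\theta$ for some $n\in\mathbb{Z}$. For integers $u_1,u_2,v_1,v_2$ define $I(u_1,u_2,v_1,v_2)=u_1v_2-v_1u_2$, $h_1=-1+2a_1u_1u_2-u_2^2(a_1a_2-a_0)+2a_1v_1v_2-v_2^2(a_1a_2-a_0)$, $h_2=-u_1^2+2a_2u_1u_2-u_2^2(a_2^2-a_1)-v_1^2+2a_2v_1v_2-v_2^2(a_2^2-a_1)$ (both functions of $(u_1,u_2,v_1,v_2)$), $U_0=v_2h_1/2-v_1h_2/2$ and $V_0=-u_2h_1/2+u_1h_2/2$. $\mathbf{S}\subset\mathbb{Z}[\theta]\times\mathbb{Z}[\theta]$ is the set of pairs $(u_0+u_1\theta+u_2\theta^2,\ v_0+v_1\theta+v_2\theta^2)$ with all $u_j,v_j\in\mathbb{Z}$ such that: (1) $v_2$ is even and $\gcd(u_2,v_2)=1$; (2) $u_1,v_1$ are odd and $I(u_1,u_2,v_1,v_2)=1$; (3) $u_0=U_0(u_1,u_2,v_1,v_2)$ and $v_0=V_0(u_1,u_2,v_1,v_2)$. -}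

module Defs where

open import Data.Nat as ℕ using (ℕ; zero; suc)
open import Data.Integer using (ℤ; +_; -_; _+_; _-_; _*_; 0ℤ; 1ℤ; -1ℤ)
open import Data.Integer.Divisibility using (_∣_)
open import Data.Integer.GCD using (gcd)
open import Data.List using (List; []; _∷_)
open import Data.Product using (Σ; ∃; _×_; _,_)
open import Data.Sum using (_⊎_)
open import Relation.Nullary using (¬_)
open import Relation.Binary.PropositionalEquality using (_≡_)

-- Polynomials in ℤ[x] as coefficient lists (constant term first).

Poly : Set
Poly = List ℤ

coeff : Poly → ℕ → ℤ
coeff []       _       = 0ℤ
coeff (c ∷ _)  zero    = c
coeff (_ ∷ cs) (suc k) = coeff cs k

mulCoeff : Poly → Poly → ℕ → ℤ
mulCoeff []       g k       = 0ℤ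
mulCoeff (c ∷ cs) g k       = c * coeff g k + mulCoeff cs g' k
  where
  g' : Poly
  g' = 0ℤ ∷ g

_·_≡ₚ_ : Poly → Poly → Poly → Set
f · g ≡ₚ h = ∀ k → mulCoeff f g k ≡ coeff h k

IsUnit : Poly → Set
IsUnit f = (coeff f 0 ≡ 1ℤ ⊎ coeff f 0 ≡ -1ℤ) × (∀ k → coeff f (suc k) ≡ 0ℤ)

IsZeroPoly : Poly → Set
IsZeroPoly f = ∀ k → coeff f k ≡ 0ℤ

Irreducible : Poly → Set
Irreducible p = ¬ IsZeroPoly p × ¬ IsUnit p
              × (∀ f g → f · g ≡ₚ p → IsUnit f ⊎ IsUnit g)

cubic : ℤ → ℤ → ℤ → Poly
cubic a₀ a₁ a₂ = a₀ ∷ a₁ ∷ a₂ ∷ 1ℤ ∷ []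

-- ℤ[θ] for θ a root of the irreducible monic cubic p: ℤ[θ] ≅ ℤ[x]/(p),
-- with ℤ-basis 1, θ, θ².  The element c₀ + c₁θ + c₂θ² is (c₀ , c₁ , c₂).

record Zθ : Set where
  constructor ⟨_,_,_⟩
  field
    c₀ c₁ c₂ : ℤ
open Zθ public

_⊕_ : Zθ → Zθ → Zθ
⟨ x₀ , x₁ , x₂ ⟩ ⊕ ⟨ y₀ , y₁ , y₂ ⟩ = ⟨ x₀ + y₀ , x₁ + y₁ , x₂ + y₂ ⟩

-- multiplication in ℤ[θ], using
--   θ³ = -a₀ - a₁θ - a₂θ²
--   θ⁴ = a₀a₂ + (a₁a₂ - a₀)θ + (a₂² - a₁)θ²
mulθ : (a₀ a₁ a₂ : ℤ) → Zθ → Zθ → Zθ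
mulθ a₀ a₁ a₂ ⟨ x₀ , x₁ , x₂ ⟩ ⟨ y₀ , y₁ , y₂ ⟩ =
  ⟨ d₀ - a₀ * d₃ + a₀ * a₂ * d₄
  , d₁ - a₁ * d₃ + (a₁ * a₂ - a₀) * d₄
  , d₂ - a₂ * d₃ + (a₂ * a₂ - a₁) * d₄ ⟩
  where
  d₀ = x₀ * y₀
  d₁ = x₀ * y₁ + x₁ * y₀
  d₂ = x₀ * y₂ + x₁ * y₁ + x₂ * y₀
  d₃ = x₁ * y₂ + x₂ * y₁
  d₄ = x₂ * y₂

InR : (a₀ a₁ a₂ : ℤ) → Zθ → Zθ → Set
InR a₀ a₁ a₂ ω₁ ω₂ =
  ∃ λ (n : ℤ) → (mulθ a₀ a₁ a₂ ω₁ ω₁ ⊕ mulθ a₀ a₁ a₂ ω₂ ω₂) ≡ ⟨ n , -1ℤ , 0ℤ ⟩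

I : ℤ → ℤ → ℤ → ℤ → ℤ
I u₁ u₂ v₁ v₂ = u₁ * v₂ - v₁ * u₂

h₁ : (a₀ a₁ a₂ : ℤ) → ℤ → ℤ → ℤ → ℤ → ℤ
h₁ a₀ a₁ a₂ u₁ u₂ v₁ v₂ =
  -1ℤ + (+ 2) * a₁ * u₁ * u₂ - u₂ * u₂ * (a₁ * a₂ - a₀)
      + (+ 2) * a₁ * v₁ * v₂ - v₂ * v₂ * (a₁ * a₂ - a₀)

h₂ : (a₀ a₁ a₂ : ℤ) → ℤ → ℤ → ℤ → ℤ → ℤ
h₂ a₀ a₁ a₂ u₁ u₂ v₁ v₂ =
  - (u₁ * u₁) + (+ 2) * a₂ * u₁ * u₂ - u₂ * u₂ * (a₂ * a₂ - a₁)
  - v₁ * v₁ + (+ 2) * a₂ * v₁ * v₂ - v₂ * v₂ * (a₂ * a₂ - a₁)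

Odd : ℤ → Set
Odd x = ¬ ((+ 2) ∣ x)

-- Condition (3), u₀ = v₂h₁/2 - v₁h₂/2 and v₀ = -u₂h₁/2 + u₁h₂/2, is stated
-- after multiplying by 2 (the equalities are between rational numbers;
-- u₀, v₀ are integers).
InS : (a₀ a₁ a₂ : ℤ) → Zθ → Zθ → Set
InS a₀ a₁ a₂ ⟨ u₀ , u₁ , u₂ ⟩ ⟨ v₀ , v₁ , v₂ ⟩ =
    ((+ 2) ∣ v₂ × gcd u₂ v₂ ≡ 1ℤ)
  × (Odd u₁ × Odd v₁ × I u₁ u₂ v₁ v₂ ≡ 1ℤ)
  × ((+ 2) * u₀ ≡ v₂ * H₁ - v₁ * H₂
     × (+ 2) * v₀ ≡ - (u₂ * H₁) + u₁ * H₂)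
  where
  H₁ = h₁ a₀ a₁ a₂ u₁ u₂ v₁ v₂
  H₂ = h₂ a₀ a₁ a₂ u₁ u₂ v₁ v₂

{-# OPTIONS --safe #-}
module Submission where

open import Defs
open import Data.Integer using (ℤ; +_; -_; _+_; _-_; _*_; 1ℤ; -1ℤ)
open import Data.Integer.Properties using (*-identityʳ; i≡j⇒i-j≡0)
open import Data.Integer.Tactic.RingSolver using (solve-∀)
open import Data.Product using (_×_; _,_)
open import Relation.Binary.PropositionalEquality
  using (_≡_; refl; trans; cong; module ≡-Reasoning)

-- The θ- and θ²-coefficients of ω₁² + ω₂² are affine in (u₀, v₀): they are
-- 2u₀u₁ + 2v₀v₁ - h₁ - 1 and 2u₀u₂ + 2v₀v₂ - h₂.  Condition (3) is Cramer's
-- rule for the linear system 2u₀u₁ + 2v₀v₁ = h₁, 2u₀u₂ + 2v₀v₂ = h₂, whose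
-- determinant is I = 1; so the two coefficients are -1 and 0.  Only I = 1 and
-- condition (3) are used.

⟨,,⟩-cong : ∀ {x₀ x₁ x₂ y₀ y₁ y₂} → x₀ ≡ y₀ → x₁ ≡ y₁ → x₂ ≡ y₂ →
            ⟨ x₀ , x₁ , x₂ ⟩ ≡ ⟨ y₀ , y₁ , y₂ ⟩
⟨,,⟩-cong refl refl refl = refl

cramer : ∀ u₁ u₂ v₁ v₂ {b₁ b₂ x y} → I u₁ u₂ v₁ v₂ ≡ 1ℤ →
         x ≡ v₂ * b₁ - v₁ * b₂ → y ≡ - (u₂ * b₁) + u₁ * b₂ →
         x * u₁ + y * v₁ ≡ b₁ × x * u₂ + y * v₂ ≡ b₂
cramer u₁ u₂ v₁ v₂ {b₁} {b₂} det refl refl =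
  cancel-det b₁ (row₁ u₁ u₂ v₁ v₂ b₁ b₂) , cancel-det b₂ (row₂ u₁ u₂ v₁ v₂ b₁ b₂)
  where
  open ≡-Reasoning
  cancel-det : ∀ b {z} → z ≡ b * (u₁ * v₂ - v₁ * u₂) → z ≡ b
  cancel-det b {z} z≡b·I = begin
    z                  ≡⟨ z≡b·I ⟩
    b * I u₁ u₂ v₁ v₂  ≡⟨ cong (b *_) det ⟩
    b * 1ℤ             ≡⟨ *-identityʳ b ⟩
    b                  ∎
  row₁ : ∀ u₁ u₂ v₁ v₂ b₁ b₂ →
    (v₂ * b₁ - v₁ * b₂) * u₁ + (- (u₂ * b₁) + u₁ * b₂) * v₁ ≡ b₁ * (u₁ * v₂ - v₁ * u₂)
  row₁ = solve-∀
  row₂ : ∀ u₁ u₂ v₁ v₂ b₁ b₂ →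
    (v₂ * b₁ - v₁ * b₂) * u₂ + (- (u₂ * b₁) + u₁ * b₂) * v₂ ≡ b₂ * (u₁ * v₂ - v₁ * u₂)
  row₂ = solve-∀

sumSquares : (a₀ a₁ a₂ : ℤ) → Zθ → Zθ → Zθ
sumSquares a₀ a₁ a₂ ω₁ ω₂ = mulθ a₀ a₁ a₂ ω₁ ω₁ ⊕ mulθ a₀ a₁ a₂ ω₂ ω₂

sumSquares-c₁ : ∀ a₀ a₁ a₂ u₀ u₁ u₂ v₀ v₁ v₂ →
  c₁ (sumSquares a₀ a₁ a₂ ⟨ u₀ , u₁ , u₂ ⟩ ⟨ v₀ , v₁ , v₂ ⟩)
    ≡ ((+ 2) * u₀ * u₁ + (+ 2) * v₀ * v₁ - h₁ a₀ a₁ a₂ u₁ u₂ v₁ v₂) - 1ℤ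
sumSquares-c₁ = expansion
  where
  -- Both sides are spelled out in full because the solver does not unfold
  -- c₁, mulθ or h₁.
  expansion : ∀ a₀ a₁ a₂ u₀ u₁ u₂ v₀ v₁ v₂ →
    (u₀ * u₁ + u₁ * u₀ - a₁ * (u₁ * u₂ + u₂ * u₁) + (a₁ * a₂ - a₀) * (u₂ * u₂))
      + (v₀ * v₁ + v₁ * v₀ - a₁ * (v₁ * v₂ + v₂ * v₁) + (a₁ * a₂ - a₀) * (v₂ * v₂))
    ≡ ((+ 2) * u₀ * u₁ + (+ 2) * v₀ * v₁
       - (-1ℤ + (+ 2) * a₁ * u₁ * u₂ - u₂ * u₂ * (a₁ * a₂ - a₀)
              + (+ 2) * a₁ * v₁ * v₂ - v₂ * v₂ * (a₁ * a₂ - a₀)))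
      - 1ℤ
  expansion = solve-∀

sumSquares-c₂ : ∀ a₀ a₁ a₂ u₀ u₁ u₂ v₀ v₁ v₂ →
  c₂ (sumSquares a₀ a₁ a₂ ⟨ u₀ , u₁ , u₂ ⟩ ⟨ v₀ , v₁ , v₂ ⟩)
    ≡ (+ 2) * u₀ * u₂ + (+ 2) * v₀ * v₂ - h₂ a₀ a₁ a₂ u₁ u₂ v₁ v₂
sumSquares-c₂ = expansion
  where
  expansion : ∀ a₀ a₁ a₂ u₀ u₁ u₂ v₀ v₁ v₂ →
    (u₀ * u₂ + u₁ * u₁ + u₂ * u₀ - a₂ * (u₁ * u₂ + u₂ * u₁) + (a₂ * a₂ - a₁) * (u₂ * u₂))
      + (v₀ * v₂ + v₁ * v₁ + v₂ * v₀ - a₂ * (v₁ * v₂ + v₂ * v₁) + (a₂ * a₂ - a₁) * (v₂ * v₂))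
    ≡ (+ 2) * u₀ * u₂ + (+ 2) * v₀ * v₂
      - (- (u₁ * u₁) + (+ 2) * a₂ * u₁ * u₂ - u₂ * u₂ * (a₂ * a₂ - a₁)
         - v₁ * v₁ + (+ 2) * a₂ * v₁ * v₂ - v₂ * v₂ * (a₂ * a₂ - a₁))
  expansion = solve-∀

lemma4p2 : (a₀ a₁ a₂ : ℤ) → Irreducible (cubic a₀ a₁ a₂)
         → (ω₁ ω₂ : Zθ) → InS a₀ a₁ a₂ ω₁ ω₂ → InR a₀ a₁ a₂ ω₁ ω₂
lemma4p2 a₀ a₁ a₂ _ ⟨ u₀ , u₁ , u₂ ⟩ ⟨ v₀ , v₁ , v₂ ⟩ (_ , (_ , _ , det) , 2u₀≡ , 2v₀≡) =
  let θ-equation , θ²-equation = cramer u₁ u₂ v₁ v₂ det 2u₀≡ 2v₀≡ in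
  _ , ⟨,,⟩-cong refl
        (trans (sumSquares-c₁ a₀ a₁ a₂ u₀ u₁ u₂ v₀ v₁ v₂) (cong (_- 1ℤ) (i≡j⇒i-j≡0 θ-equation)))
        (trans (sumSquares-c₂ a₀ a₁ a₂ u₀ u₁ u₂ v₀ v₁ v₂) (i≡j⇒i-j≡0 θ²-equation))
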